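{- Let $k\geq 2$, $n\geq 0$, let $(0,0),(1,z_1),\ldots,(kn,z_{kn}),(kn+1,1)$ be an augmented $k$-Catalan path of order $n$, and let $(0,0),(1,z'_1),\ldots,(kn,z'_{kn}),(kn+1,0)$ be the corresponding $k$-Catalan--Spitzer path. Then for $i\neq j$ in $\{1,\ldots,kn\}$, we have $z'_i<z'_j$ if and only if $(-i,z_i)<(-j,z_j)$ in the reverse lexicographic order (coordinates compared right to left), i.e., if and only if either $z_i<z_j$, or $z_i=z_j$ and $i>j$.
   Context: An augmented $k$-Catalan path of order $n$ is a lattice path $(0,z_0),(1,z_1),\ldots,(kn+1,z_{kn+1})$ with $z_0=0$ whose steps are $(k-1)n+1$ up steps $(1,1)$ and $n$ down steps $(1,1-k)$, whose first step is an up step, and with $z_i\geq 1$ for all $1\leq i\leq kn+1$. A $k$-Catalan--Spitzer path of order $n$ is a lattice path from $(0,0)$ to $(kn+1,0)$ consisting of $(k-1)n+1$ up steps $(1,n)$ and $n$ down steps $(1,-((k-1)n+1))$ that stays strictly above the line $y=0$ except at its endpoints. The $k$-Catalan--Spitzer path corresponding to an augmented $k$-Catalan path is the one in which up steps and down steps occur in the same order. -}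

module Defs where

open import Data.Bool using (Bool; true; false; if_then_else_)
open import Data.Nat using (ℕ; zero; suc; _+_; _*_; _∸_; _≤_)
open import Data.List using (List; []; _∷_; length; take; map; sum)
open import Data.Integer as ℤ using (ℤ; +_; -_)
open import Data.Product using (Σ; _×_)
open import Relation.Binary.PropositionalEquality using (_≡_)

-- A lattice path is encoded by its sequence of steps: true = up step, false = down step.
Steps : Set
Steps = List Bool

#up : Steps → ℕ
#up []          = 0
#up (true ∷ s)  = suc (#up s)
#up (false ∷ s) = #up s

#down : Steps → ℕ
#down []          = 0
#down (true ∷ s)  = #down s
#down (false ∷ s) = suc (#down s)

height : ℤ → ℤ → Steps → ℕ → ℤ
height u d s zero = + 0
height u d [] (suc i) = + 0
height u d (b ∷ s) (suc i) = (if b then u else d) ℤ.+ height u d s i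

catZ : ℕ → Steps → ℕ → ℤ
catZ k = height (+ 1) (+ 1 ℤ.- + k)

spitzerZ : ℕ → ℕ → Steps → ℕ → ℤ
spitzerZ k n = height (+ n) (- (+ ((k ∸ 1) * n + 1)))

record AugmentedCatalan (k n : ℕ) (s : Steps) : Set where
  field
    len        : length s ≡ k * n + 1
    ups        : #up s ≡ (k ∸ 1) * n + 1
    downs      : #down s ≡ n
    firstUp    : Σ Steps (λ t → s ≡ true ∷ t)
    positive   : ∀ i → 1 ≤ i → i ≤ k * n + 1 → + 1 ℤ.≤ catZ k s i

-- Write k = K + 1, and let u_i, d_i be the numbers of up and down steps among the
-- first i steps. Then z_i = u_i − K d_i and z'_i = n u_i − (K n + 1) d_i = n z_i − d_i.
-- Positivity of z_i together with i = z_i + k d_i ≤ k n forces 0 ≤ d_i < n, so z'_i is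
-- z_i written in base n with a "negative digit" d_i: comparing z'_i and z'_j compares
-- z_i and z_j first and breaks ties by d_j < d_i, which for equal heights is j < i.
module Submission where

open import Defs
open import Data.Nat using (ℕ; _≤_; _<_; _*_)
open import Data.Integer as ℤ using (ℤ)
open import Data.Product using (_×_)
open import Data.Sum using (_⊎_)
open import Function.Bundles using (_⇔_)
open import Relation.Binary.PropositionalEquality using (_≡_; _≢_)

open import Level using (0ℓ)
open import Data.Bool using (true; false)
open import Data.Nat using (zero; suc; _+_; s≤s; NonZero)
import Data.Nat.Properties as ℕ
import Data.Nat.Tactic.RingSolver as ℕ-Solver
open import Data.Integer using (+_; _-_)
import Data.Integer.Properties as ℤ
open import Data.Integer.Tactic.RingSolver using (solve-∀)
open import Data.List using ([]; _∷_; length; take)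
open import Data.Product using (∃-syntax; _,_)
open import Data.Sum using (inj₁; inj₂)
open import Data.Sum.Function.Propositional using (_⊎-⇔_)
open import Data.Product.Function.NonDependent.Propositional using (_×-⇔_)
open import Function.Bundles using (mk⇔)
open import Function.Properties.Equivalence using (⇔-setoid)
import Function.Properties.Equivalence as ⇔
open import Relation.Binary.PropositionalEquality
  using (refl; sym; trans; cong; cong₂; subst; subst₂; module ≡-Reasoning)
open import Relation.Binary.Definitions using (tri<; tri≈; tri>)
open import Relation.Nullary using (contradiction)
import Relation.Binary.Reasoning.Setoid

ups downs : ℕ → Steps → ℕ
ups i s = #up (take i s)
downs i s = #down (take i s)

height-take : ∀ u d s i → height u d s i ≡ + ups i s ℤ.* u ℤ.+ + downs i s ℤ.* d
height-take u d s       zero    = solve-∀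
height-take u d []      (suc i) = solve-∀
height-take u d (true ∷ s) (suc i)
  rewrite height-take u d s i | ℤ.pos-+ 1 (ups i s) = up (+ ups i s) (+ downs i s) u d
  where
  up : ∀ U D u d → u ℤ.+ (U ℤ.* u ℤ.+ D ℤ.* d) ≡ (+ 1 ℤ.+ U) ℤ.* u ℤ.+ D ℤ.* d
  up = solve-∀
height-take u d (false ∷ s) (suc i)
  rewrite height-take u d s i | ℤ.pos-+ 1 (downs i s) = down (+ ups i s) (+ downs i s) u d
  where
  down : ∀ U D u d → d ℤ.+ (U ℤ.* u ℤ.+ D ℤ.* d) ≡ U ℤ.* u ℤ.+ (+ 1 ℤ.+ D) ℤ.* d
  down = solve-∀

ups+downs : ∀ {i} s → i ≤ length s → ups i s + downs i s ≡ i
ups+downs {zero}  s           _           = refl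
ups+downs {suc i} (true ∷ s)  (s≤s i≤) = cong suc (ups+downs s i≤)
ups+downs {suc i} (false ∷ s) (s≤s i≤) =
  trans (ℕ.+-suc (ups i s) (downs i s)) (cong suc (ups+downs s i≤))

ups≡catZ+K*downs : ∀ K s i → + ups i s ≡ catZ (suc K) s i ℤ.+ + K ℤ.* + downs i s
ups≡catZ+K*downs K s i = begin
  + U                                                     ≡⟨ identity (+ U) (+ D) (+ K) ⟩
  (+ U ℤ.* + 1 ℤ.+ + D ℤ.* (+ 1 - + suc K)) ℤ.+ + K ℤ.* + D
    ≡⟨ cong (ℤ._+ + K ℤ.* + D) (height-take (+ 1) (+ 1 - + suc K) s i) ⟨
  catZ (suc K) s i ℤ.+ + K ℤ.* + D                        ∎
  where
  open ≡-Reasoning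
  U D : ℕ
  U = ups i s
  D = downs i s
  identity : ∀ U D K → U ≡ (U ℤ.* + 1 ℤ.+ D ℤ.* (+ 1 - (+ 1 ℤ.+ K))) ℤ.+ K ℤ.* D
  identity = solve-∀

spitzerZ≡n*catZ-downs : ∀ K n s i →
  spitzerZ (suc K) n s i ≡ + n ℤ.* catZ (suc K) s i - + downs i s
spitzerZ≡n*catZ-downs K n s i = begin
  spitzerZ (suc K) n s i                       ≡⟨ height-take (+ n) (ℤ.- + (K * n + 1)) s i ⟩
  + U ℤ.* + n ℤ.+ + D ℤ.* ℤ.- + (K * n + 1)    ≡⟨ cong (λ c → + U ℤ.* + n ℤ.+ + D ℤ.* ℤ.- c) Kn+1 ⟩
  + U ℤ.* + n ℤ.+ + D ℤ.* ℤ.- (+ K ℤ.* + n ℤ.+ + 1)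
    ≡⟨ identity (+ U) (+ D) (+ K) (+ n) ⟩
  + n ℤ.* (+ U ℤ.* + 1 ℤ.+ + D ℤ.* (+ 1 - + suc K)) - + D
    ≡⟨ cong (λ z → + n ℤ.* z - + D) (height-take (+ 1) (+ 1 - + suc K) s i) ⟨
  + n ℤ.* catZ (suc K) s i - + D               ∎
  where
  open ≡-Reasoning
  U D : ℕ
  U = ups i s
  D = downs i s
  Kn+1 : + (K * n + 1) ≡ + K ℤ.* + n ℤ.+ + 1
  Kn+1 = trans (ℤ.pos-+ (K * n) 1) (cong (ℤ._+ + 1) (ℤ.pos-* K n))
  identity : ∀ U D K n →
    U ℤ.* n ℤ.+ D ℤ.* ℤ.- (K ℤ.* n ℤ.+ + 1)
      ≡ n ℤ.* (U ℤ.* + 1 ℤ.+ D ℤ.* (+ 1 - (+ 1 ℤ.+ K))) - D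
  identity = solve-∀

positive⇒pos : ∀ {z} → + 1 ℤ.≤ z → ∃[ x ] (1 ≤ x × z ≡ + x)
positive⇒pos (ℤ.+≤+ 1≤x) = _ , 1≤x , refl

record Position (K n : ℕ) (s : Steps) (i : ℕ) : Set where
  field
    z d       : ℕ
    catZ≡     : catZ (suc K) s i ≡ + z
    spitzerZ≡ : spitzerZ (suc K) n s i ≡ + (z * n) - + d
    index≡    : i ≡ z + suc K * d
    d<n       : d < n

position : ∀ K n s i → + 1 ℤ.≤ catZ (suc K) s i → i ≤ length s → i ≤ suc K * n →
  Position K n s i
position K n s i catZ-pos i≤len i≤kn with positive⇒pos catZ-pos
... | z , 1≤z , catZ≡z = record
  { z = z ; d = D ; catZ≡ = catZ≡z ; spitzerZ≡ = spitzerZ≡ ; index≡ = index≡ ; d<n = d<n }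
  where
  U D : ℕ
  U = ups i s
  D = downs i s
  U≡ : U ≡ z + K * D
  U≡ = ℤ.+-injective (begin
    + U                               ≡⟨ ups≡catZ+K*downs K s i ⟩
    catZ (suc K) s i ℤ.+ + K ℤ.* + D  ≡⟨ cong (ℤ._+ + K ℤ.* + D) catZ≡z ⟩
    + z ℤ.+ + K ℤ.* + D               ≡⟨ cong (ℤ._+_ (+ z)) (ℤ.pos-* K D) ⟨
    + z ℤ.+ + (K * D)                 ≡⟨ ℤ.pos-+ z (K * D) ⟨
    + (z + K * D)                     ∎)
    where open ≡-Reasoning
  index≡ : i ≡ z + suc K * D
  index≡ = begin
    i                  ≡⟨ ups+downs s i≤len ⟨
    U + D              ≡⟨ cong (_+ D) U≡ ⟩
    z + K * D + D      ≡⟨ regroup z K D ⟩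
    z + suc K * D      ∎
    where
    open ≡-Reasoning
    regroup : ∀ z K D → z + K * D + D ≡ z + suc K * D
    regroup = ℕ-Solver.solve-∀
  d<n : D < n
  d<n = ℕ.*-cancelˡ-< (suc K) D n (ℕ.<-≤-trans kD<i i≤kn)
    where
    kD<i : suc K * D < i
    kD<i = subst (suc K * D <_) (sym index≡) (ℕ.m<n+m (suc K * D) 1≤z)
  spitzerZ≡ : spitzerZ (suc K) n s i ≡ + (z * n) - + D
  spitzerZ≡ = begin
    spitzerZ (suc K) n s i              ≡⟨ spitzerZ≡n*catZ-downs K n s i ⟩
    + n ℤ.* catZ (suc K) s i - + D      ≡⟨ cong (λ c → + n ℤ.* c - + D) catZ≡z ⟩
    + n ℤ.* + z - + D                   ≡⟨ cong (_- + D) (ℤ.pos-* n z) ⟨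
    + (n * z) - + D                     ≡⟨ cong (λ m → + m - + D) (ℕ.*-comm n z) ⟩
    + (z * n) - + D                     ∎
    where open ≡-Reasoning

+-<⇔ : ∀ {m n} → + m ℤ.< + n ⇔ m < n
+-<⇔ = mk⇔ ℤ.drop‿+<+ ℤ.+<+

+-≡⇔ : ∀ {m n} → + m ≡ + n ⇔ m ≡ n
+-≡⇔ = mk⇔ ℤ.+-injective (cong (λ m → + m))

i-j<k-l⇔i+l<k+j : ∀ i j k l → i - j ℤ.< k - l ⇔ i ℤ.+ l ℤ.< k ℤ.+ j
i-j<k-l⇔i+l<k+j i j k l = mk⇔
  (λ lt → subst₂ ℤ._<_ (add i j l) (add′ k j l) (ℤ.+-monoˡ-< (j ℤ.+ l) lt))
  (λ lt → subst₂ ℤ._<_ (sub i j l) (sub′ k j l) (ℤ.+-monoˡ-< (ℤ.- (j ℤ.+ l)) lt))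
  where
  add : ∀ i j l → (i - j) ℤ.+ (j ℤ.+ l) ≡ i ℤ.+ l
  add = solve-∀
  add′ : ∀ k j l → (k - l) ℤ.+ (j ℤ.+ l) ≡ k ℤ.+ j
  add′ = solve-∀
  sub : ∀ i j l → (i ℤ.+ l) ℤ.+ ℤ.- (j ℤ.+ l) ≡ i - j
  sub = solve-∀
  sub′ : ∀ k j l → (k ℤ.+ j) ℤ.+ ℤ.- (j ℤ.+ l) ≡ k - l
  sub′ = solve-∀

+m-+n<+o-+p⇔m+p<o+n : ∀ m n o p → + m - + n ℤ.< + o - + p ⇔ m + p < o + n
+m-+n<+o-+p⇔m+p<o+n m n o p =
  ⇔.trans (i-j<k-l⇔i+l<k+j (+ m) (+ n) (+ o) (+ p))
    (subst₂ (λ a b → a ℤ.< b ⇔ m + p < o + n) (ℤ.pos-+ m p) (ℤ.pos-+ o n) +-<⇔)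

*+<*+⇔lex : ∀ {n a b} x y → a < n → b < n →
  x * n + b < y * n + a ⇔ (x < y ⊎ (x ≡ y × b < a))
*+<*+⇔lex {n} {a} {b} x y a<n b<n = mk⇔ to from
  where
  carry : ∀ {x y a b} → b < n → x < y → x * n + b < y * n + a
  carry {x} {y} {a} {b} b<n x<y = begin-strict
    x * n + b   <⟨ ℕ.+-monoʳ-< (x * n) b<n ⟩
    x * n + n   ≡⟨ ℕ.+-comm (x * n) n ⟩
    suc x * n   ≤⟨ ℕ.*-monoˡ-≤ n x<y ⟩
    y * n       ≤⟨ ℕ.m≤m+n (y * n) a ⟩
    y * n + a   ∎
    where open ℕ.≤-Reasoning
  to : x * n + b < y * n + a → x < y ⊎ (x ≡ y × b < a)
  to lt with ℕ.<-cmp x y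
  ... | tri< x<y _ _ = inj₁ x<y
  ... | tri≈ _ refl _ = inj₂ (refl , ℕ.+-cancelˡ-< (x * n) b a lt)
  ... | tri> _ _ y<x = contradiction (carry a<n y<x) (ℕ.<-asym lt)
  from : x < y ⊎ (x ≡ y × b < a) → x * n + b < y * n + a
  from (inj₁ x<y)          = carry b<n x<y
  from (inj₂ (refl , b<a)) = ℕ.+-monoʳ-< (x * n) b<a

sameHeight-downs⇔index : ∀ {k z z′ a b i j} .{{_ : NonZero k}} →
  i ≡ z + k * a → j ≡ z′ + k * b → (z ≡ z′ × b < a) ⇔ (z ≡ z′ × j < i)
sameHeight-downs⇔index {k} {z} {a = a} {b} refl refl = mk⇔
  (λ { (refl , b<a) → refl , ℕ.+-monoʳ-< z (ℕ.*-monoʳ-< k b<a) })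
  (λ { (refl , j<i) → refl , ℕ.*-cancelˡ-< k b a (ℕ.+-cancelˡ-< z (k * b) (k * a) j<i) })

proposition3p2 : (k n : ℕ) → 2 ≤ k → (s : Steps) → AugmentedCatalan k n s →
    (i j : ℕ) → 1 ≤ i → i ≤ k * n → 1 ≤ j → j ≤ k * n → i ≢ j →
    (spitzerZ k n s i ℤ.< spitzerZ k n s j) ⇔
      ((catZ k s i ℤ.< catZ k s j) ⊎ ((catZ k s i ≡ catZ k s j) × (j < i)))
proposition3p2 (suc K) n _ s A i j 1≤i i≤kn 1≤j j≤kn _ = begin
  spitzerZ (suc K) n s i ℤ.< spitzerZ (suc K) n s j
    ≡⟨ cong₂ ℤ._<_ P.spitzerZ≡ Q.spitzerZ≡ ⟩
  + (P.z * n) - + P.d ℤ.< + (Q.z * n) - + Q.d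
    ≈⟨ +m-+n<+o-+p⇔m+p<o+n (P.z * n) P.d (Q.z * n) Q.d ⟩
  P.z * n + Q.d < Q.z * n + P.d
    ≈⟨ *+<*+⇔lex P.z Q.z P.d<n Q.d<n ⟩
  (P.z < Q.z ⊎ (P.z ≡ Q.z × Q.d < P.d))
    ≈⟨ ⇔.sym +-<⇔ ⊎-⇔ sameHeight-downs⇔index {suc K} P.index≡ Q.index≡ ⟩
  (+ P.z ℤ.< + Q.z ⊎ (P.z ≡ Q.z × j < i))
    ≈⟨ ⇔.refl ⊎-⇔ (⇔.sym +-≡⇔ ×-⇔ ⇔.refl) ⟩
  (+ P.z ℤ.< + Q.z ⊎ (+ P.z ≡ + Q.z × j < i))
    ≡⟨ cong₂ (λ a b → a ℤ.< b ⊎ (a ≡ b × j < i)) P.catZ≡ Q.catZ≡ ⟨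
  (catZ (suc K) s i ℤ.< catZ (suc K) s j ⊎ (catZ (suc K) s i ≡ catZ (suc K) s j × j < i)) ∎
  where
  open AugmentedCatalan A using (len; positive)
  open Relation.Binary.Reasoning.Setoid (⇔-setoid 0ℓ)
  position-at : ∀ {m} → 1 ≤ m → m ≤ suc K * n → Position K n s m
  position-at {m} 1≤m m≤kn =
    position K n s m (positive m 1≤m m≤kn+1) (subst (m ≤_) (sym len) m≤kn+1) m≤kn
    where
    m≤kn+1 : m ≤ suc K * n + 1
    m≤kn+1 = ℕ.m≤n⇒m≤n+o 1 m≤kn
  module P = Position (position-at 1≤i i≤kn)
  module Q = Position (position-at 1≤j j≤kn)
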